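{- Let $G$ be a finite simple graph with totally ordered vertex set $I$. A multilinear heap $E$ over $G$ is Lyndon if and only if $E$ is an admissible pyramid.
   Context: Heaps: two vertices commute if distinct and non-adjacent; heaps are elements of the quotient of the free monoid on $I$ by the congruence generated by $ab=ba$ for commuting $a,b$, with product $\circ$ induced by concatenation. For a word $p_1\cdots p_r$ its pieces are partially ordered by the transitive closure of $p_s<p_t$ when $s<t$ and $p_s,p_t$ are equal or adjacent; this poset depends only on the heap. A heap is multilinear if each vertex of $G$ occurs exactly once. A pyramid is a heap with a unique minimal piece (its basis); it is admissible if the position of its basis is the least (in the order on $I$) among the positions of its pieces. Order words lexicographically (proper prefix smaller); $\operatorname{st}(E)$ is the largest word representing $E$ and $E\le F$ iff $\operatorname{st}(E)\le\operatorname{st}(F)$. $E$ is primitive if $E=U\circ V=V\circ U$ forces $U$ or $V$ empty; conjugacy is the transitive closure of $U\circ V\mapsto V\circ U$; a Lyndon heap is nonempty, primitive and minimal in its conjugacy class. -}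

module Defs where

open import Data.Nat using (ℕ)
open import Data.Fin using (Fin; _<_; _≤_; _≟_)
open import Data.List using (List; []; _∷_; _++_; length; filter; lookup)
open import Data.Product using (Σ; ∃; ∃-syntax; _×_; _,_)
open import Data.Sum using (_⊎_)
open import Relation.Nullary using (¬_)
open import Relation.Binary.PropositionalEquality using (_≡_; _≢_)
open import Relation.Binary.Construct.Closure.Equivalence using (EqClosure)
open import Relation.Binary.Construct.Closure.ReflexiveTransitive using (Star)
open import Relation.Binary.Construct.Closure.Transitive using (TransClosure)

-- A finite simple graph on the totally ordered vertex set I = Fin n
-- (ordered by the usual order of Fin n).
record SimpleGraph (n : ℕ) : Set₁ where
  field
    Adj       : Fin n → Fin n → Set
    Adj-sym   : ∀ {a b} → Adj a b → Adj b a
    Adj-irrefl : ∀ {a} → ¬ Adj a a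

module _ {n : ℕ} (G : SimpleGraph n) where
  open SimpleGraph G

  Commute : Fin n → Fin n → Set
  Commute a b = a ≢ b × ¬ Adj a b

  data Swap : List (Fin n) → List (Fin n) → Set where
    swap : ∀ u a b v → Commute a b → Swap (u ++ a ∷ b ∷ v) (u ++ b ∷ a ∷ v)

  -- equality of heaps: the congruence generated by ab = ba for commuting a, b.
  -- A heap is represented by any of its words; the product ∘ is _++_.
  _~_ : List (Fin n) → List (Fin n) → Set
  _~_ = EqClosure Swap

  -- pieces of a word w are its positions; p_s < p_t (generating relation)
  data Below (w : List (Fin n)) : Fin (length w) → Fin (length w) → Set where
    below : ∀ {s t} → s < t → (lookup w s ≡ lookup w t ⊎ Adj (lookup w s) (lookup w t))
          → Below w s t

  PieceLt : (w : List (Fin n)) → Fin (length w) → Fin (length w) → Set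
  PieceLt w = TransClosure (Below w)

  MinimalPiece : (w : List (Fin n)) → Fin (length w) → Set
  MinimalPiece w t = ∀ s → ¬ PieceLt w s t

  PyramidWithBasis : (w : List (Fin n)) → Fin (length w) → Set
  PyramidWithBasis w b = MinimalPiece w b × (∀ t → MinimalPiece w t → t ≡ b)

  Pyramid : List (Fin n) → Set
  Pyramid w = ∃[ b ] PyramidWithBasis w b

  -- admissible: the position (vertex) of the basis is least among positions of pieces
  AdmissiblePyramid : List (Fin n) → Set
  AdmissiblePyramid w = ∃[ b ] (PyramidWithBasis w b × (∀ i → lookup w b ≤ lookup w i))

  Multilinear : List (Fin n) → Set
  Multilinear w = ∀ v → length (filter (v ≟_) w) ≡ 1

data _≤lex_ {n : ℕ} : List (Fin n) → List (Fin n) → Set where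
  []≤   : ∀ {v} → [] ≤lex v
  head< : ∀ {a b u v} → a < b → (a ∷ u) ≤lex (b ∷ v)
  head≡ : ∀ {a u v} → u ≤lex v → (a ∷ u) ≤lex (a ∷ v)

module _ {n : ℕ} (G : SimpleGraph n) where

  IsSt : List (Fin n) → List (Fin n) → Set
  IsSt s e = _~_ G s e × (∀ v → _~_ G v e → v ≤lex s)

  HeapLe : List (Fin n) → List (Fin n) → Set
  HeapLe e f = ∀ s t → IsSt s e → IsSt t f → s ≤lex t

  Primitive : List (Fin n) → Set
  Primitive e = ∀ u v → _~_ G (u ++ v) e → _~_ G (v ++ u) e → u ≡ [] ⊎ v ≡ []

  ConjStep : List (Fin n) → List (Fin n) → Set
  ConjStep e f = ∃[ u ] ∃[ v ] (_~_ G e (u ++ v) × _~_ G f (v ++ u))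

  Conjugate : List (Fin n) → List (Fin n) → Set
  Conjugate = Star ConjStep

  Lyndon : List (Fin n) → Set
  Lyndon e = e ≢ [] × Primitive e × (∀ f → Conjugate e f → HeapLe e f)

module Submission where

-- Heaps are handled through duplicate-free words.  Equivalent words are
-- permutations, commutation never reorders adjacent letters, and conversely a
-- heap is determined by its letters and the order of its adjacent pairs (the
-- orientation criterion); so st(E) exists once adjacency is decidable.
-- Minimal pieces are sources (letters with no adjacent predecessor), and st(E)
-- begins with a letter ≥ every source.  Along conjugations a height function,
-- counting the rotations of each letter, records which adjacent pairs are reversed.
-- (⇐) The basis m begins every word of E, so E is primitive.  For a conjugate F,
-- st(F) begins with a letter > m, or F is a pyramid with basis m; then heights
-- are constant along chains from m, no pair is reversed and F = E.
-- (⇒) Primitivity lets rotations grow a conjugate F which is a pyramid with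
-- basis the least vertex z; st(E) ≤ st(F) forces every source of E to be z.
-- Both conclusions are decidable, so decidable adjacency may be assumed.

open import Defs
open import Data.Nat as ℕ using (ℕ; zero; suc)
import Data.Nat.Properties as ℕ
open import Data.Fin as Fin using (Fin; _≟_)
import Data.Fin.Properties as Fin
open import Data.List using (List; []; _∷_; _++_; [_]; length; lookup; filter; map; concatMap; allFin)
open import Data.List.Properties using (++-assoc; ++-identityʳ; length-++-comm; length-++-sucʳ)
open import Data.List.Relation.Unary.All.Properties using (all-filter)
open import Data.List.Membership.Propositional using (_∈_; _∉_; find; lose)
open import Data.List.Membership.Propositional.Properties
  using (∉[]; ∈-++⁺ˡ; ∈-++⁺ʳ; ∈-++⁻; ∈-∃++; ∈-lookup; ∈-map⁺; ∈-concatMap⁺; ∈-allFin; ∈-filter⁺; ∈-filter⁻)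
open import Data.List.Relation.Unary.Any as Any using (Any; here; there; index; any?)
open import Data.List.Relation.Unary.First using () renaming (_++_∷_ to _before_then_)
open import Data.List.Relation.Unary.First.Properties using (cofirst?; toView; ¬First⇒All)
open import Data.List.Relation.Unary.Any.Properties using (lookup-index)
open import Data.List.Relation.Unary.All as All using (All; []; _∷_)
open import Data.List.Relation.Unary.Unique.Propositional using (Unique; []; _∷_)
  renaming (tail to Unique-tail)
import Data.List.Relation.Unary.Unique.Propositional.Properties as Unique
open import Data.List.Relation.Binary.Permutation.Propositional
  using (_↭_; ↭-refl; ↭-sym; ↭-trans; ↭-swap; ↭-isEquivalence; ↭⇒↭ₛ)
open import Data.List.Relation.Binary.Permutation.Propositional.Properties
  using (∈-resp-↭; ↭-length; ++⁺ˡ; ++-comm; shift)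
import Data.List.Relation.Binary.Permutation.Setoid.Properties as Permutationₛ
open import Data.Product as Product using (∃₂; ∃-syntax; _×_; _,_; proj₁; proj₂)
open import Data.Sum as Sum using (_⊎_; inj₁; inj₂)
open import Data.Empty using (⊥; ⊥-elim)
open import Function.Bundles using (_⇔_; mk⇔)
open import Relation.Nullary using (¬_; Dec; yes; no; ¬?; _×-dec_; _→-dec_)
open import Relation.Nullary.Decidable using (decidable-stable; ¬¬-excluded-middle)
import Relation.Nullary.Decidable as Dec
open import Relation.Unary using () renaming (Decidable to Decidable₁)
open import Function using (_∘_)
open import Relation.Binary using (Decidable; tri<; tri≈; tri>)
open import Relation.Binary.PropositionalEquality
  using (_≡_; _≢_; refl; sym; trans; cong; subst; setoid; module ≡-Reasoning)
open import Relation.Binary.Construct.Closure.ReflexiveTransitive using (ε; _◅_; _◅◅_)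
open import Relation.Binary.Construct.Closure.Transitive using (_∷_)
  renaming ([_] to step)
open import Relation.Binary.Construct.Closure.Symmetric using (fwd; bwd)
import Relation.Binary.Construct.Closure.Equivalence as EqClosure

module _ {n : ℕ} where

  ≤lex-refl : (w : List (Fin n)) → w ≤lex w
  ≤lex-refl [] = []≤
  ≤lex-refl (a ∷ w) = head≡ (≤lex-refl w)

  ≤lex-trans : {u v w : List (Fin n)} → u ≤lex v → v ≤lex w → u ≤lex w
  ≤lex-trans []≤ _ = []≤
  ≤lex-trans (head< a<b) (head< b<c) = head< (Fin.<-trans a<b b<c)
  ≤lex-trans (head< a<b) (head≡ _) = head< a<b
  ≤lex-trans (head≡ _) (head< a<b) = head< a<b
  ≤lex-trans (head≡ u≤v) (head≡ v≤w) = head≡ (≤lex-trans u≤v v≤w)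

  ≤lex-total : (u v : List (Fin n)) → u ≤lex v ⊎ v ≤lex u
  ≤lex-total [] v = inj₁ []≤
  ≤lex-total (a ∷ u) [] = inj₂ []≤
  ≤lex-total (a ∷ u) (b ∷ v) with Fin.<-cmp a b
  ... | tri< a<b _ _ = inj₁ (head< a<b)
  ... | tri> _ _ b<a = inj₂ (head< b<a)
  ... | tri≈ _ refl _ = Sum.map head≡ head≡ (≤lex-total u v)

  _≤lex?_ : (u v : List (Fin n)) → Dec (u ≤lex v)
  [] ≤lex? v = yes []≤
  (a ∷ u) ≤lex? [] = no λ ()
  (a ∷ u) ≤lex? (b ∷ v) with Fin.<-cmp a b
  ... | tri< a<b _ _ = yes (head< a<b)
  ... | tri> a≮b a≢b _ = no λ { (head< a<b) → a≮b a<b ; (head≡ _) → a≢b refl }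
  ... | tri≈ a≮b refl _ with u ≤lex? v
  ...   | yes u≤v = yes (head≡ u≤v)
  ...   | no u≰v = no λ { (head< a<a) → a≮b a<a ; (head≡ u≤v) → u≰v u≤v }

  ≤lex-head : {a b : Fin n} {u v : List (Fin n)} → (a ∷ u) ≤lex (b ∷ v) → a Fin.≤ b
  ≤lex-head (head< a<b) = ℕ.<⇒≤ a<b
  ≤lex-head (head≡ _) = Fin.≤-refl

  ≤lex-maximum : (d : List (Fin n)) (ds : List (List (Fin n))) →
                 ∃[ s ] (s ∈ d ∷ ds × (∀ {v} → v ∈ d ∷ ds → v ≤lex s))
  ≤lex-maximum d [] = d , here refl , λ { (here refl) → ≤lex-refl d }
  ≤lex-maximum d (d′ ∷ ds) with ≤lex-maximum d′ ds
  ... | s , s∈ , s-max with ≤lex-total d s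
  ...   | inj₁ d≤s = s , there s∈ , λ { (here refl) → d≤s ; (there v∈) → s-max v∈ }
  ...   | inj₂ s≤d = d , here refl , λ { (here refl) → ≤lex-refl d
                                         ; (there v∈) → ≤lex-trans (s-max v∈) s≤d }

  words : ℕ → List (List (Fin n))
  words zero = [] ∷ []
  words (suc k) = concatMap (λ a → map (a ∷_) (words k)) (allFin n)

  ∈-words : (v : List (Fin n)) → v ∈ words (length v)
  ∈-words [] = here refl
  ∈-words (a ∷ v) = ∈-concatMap⁺ (λ b → map (b ∷_) (words (length v)))
    (Any.map (λ { refl → ∈-map⁺ (a ∷_) (∈-words v) }) (∈-allFin a))

¬¬-∀-Fin : ∀ {k} {Q : Fin k → Set} → (∀ i → ¬ ¬ Q i) → ¬ ¬ (∀ i → Q i)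
¬¬-∀-Fin {zero} _ ¬all = ¬all λ ()
¬¬-∀-Fin {suc k} ¬¬Q ¬all = ¬¬Q Fin.zero λ q₀ →
  ¬¬-∀-Fin (λ i → ¬¬Q (Fin.suc i)) λ qs → ¬all λ { Fin.zero → q₀ ; (Fin.suc i) → qs i }

module _ {n : ℕ} (G : SimpleGraph n) where
  open import Data.List.Membership.DecPropositional (_≟_ {n}) using (_∈?_)
  open import Data.List.Relation.Unary.Unique.DecPropositional (_≟_ {n}) using (unique?)
  open SimpleGraph G

  Vertex : Set
  Vertex = Fin n

  Word : Set
  Word = List Vertex

  infix 4 _≈_
  _≈_ : Word → Word → Set
  _≈_ = _~_ G

  private variable
    a b c d m : Vertex
    e f s t u v w z : Word

  ≈-sym : v ≈ w → w ≈ v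
  ≈-sym = EqClosure.symmetric (Swap G)

  ≈-trans : u ≈ v → v ≈ w → u ≈ w
  ≈-trans = _◅◅_

  ≡⇒≈ : v ≡ w → v ≈ w
  ≡⇒≈ refl = ε

  Commute-sym : Commute G a b → Commute G b a
  Commute-sym (a≢b , ¬adj) = (λ b≡a → a≢b (sym b≡a)) , (λ adj → ¬adj (Adj-sym adj))

  commute : ∀ u a b v → Commute G a b → (u ++ a ∷ b ∷ v) ≈ (u ++ b ∷ a ∷ v)
  commute u a b v ab = EqClosure.return (swap u a b v ab)

  ≈-∷ : ∀ c → v ≈ w → (c ∷ v) ≈ (c ∷ w)
  ≈-∷ c = EqClosure.gmap (c ∷_) λ { (swap u a b v ab) → swap (c ∷ u) a b v ab }

  ≈-++ʳ : ∀ u → v ≈ w → (v ++ u) ≈ (w ++ u)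
  ≈-++ʳ u = EqClosure.gmap (_++ u) swap-++ʳ
    where
      swap-++ʳ : Swap G v w → Swap G (v ++ u) (w ++ u)
      swap-++ʳ (swap x a b y ab) rewrite ++-assoc x (a ∷ b ∷ y) u | ++-assoc x (b ∷ a ∷ y) u =
        swap x a b (y ++ u) ab

  bubble : ∀ x c z → All (λ d → Commute G d c) x → (x ++ c ∷ z) ≈ (c ∷ x ++ z)
  bubble [] c z [] = ε
  bubble (d ∷ x) c z (dc ∷ xc) = ≈-trans (≈-∷ d (bubble x c z xc)) (commute [] d c (x ++ z) dc)

  exchange : ∀ A B → All (λ a → All (Commute G a) B) A → (A ++ B) ≈ (B ++ A)
  exchange [] B [] = ≡⇒≈ (sym (++-identityʳ B))
  exchange (a ∷ A) B (aB ∷ AB) =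
    ≈-trans (≈-∷ a (exchange A B AB)) (≈-sym (bubble B a A (All.map Commute-sym aB)))

  ≈⇒↭ : v ≈ w → v ↭ w
  ≈⇒↭ = EqClosure.fold ↭-isEquivalence λ { (swap u a b v _) → ++⁺ˡ u (↭-swap a b ↭-refl) }

  ∈-≈ : v ≈ w → a ∈ v → a ∈ w
  ∈-≈ v≈w = ∈-resp-↭ (≈⇒↭ v≈w)

  Unique-↭ : v ↭ w → Unique v → Unique w
  Unique-↭ v↭w = Permutationₛ.Unique-resp-↭ (setoid Vertex) (↭⇒↭ₛ v↭w)

  Unique-≈ : v ≈ w → Unique v → Unique w
  Unique-≈ v≈w = Unique-↭ (≈⇒↭ v≈w)

  conjugate⇒↭ : Conjugate G e f → e ↭ f
  conjugate⇒↭ ε = ↭-refl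
  conjugate⇒↭ ((u , v , e≈uv , f≈vu) ◅ fs) =
    ↭-trans (≈⇒↭ e≈uv) (↭-trans (++-comm u v) (↭-trans (↭-sym (≈⇒↭ f≈vu)) (conjugate⇒↭ fs)))

  conjugate-Unique : Conjugate G e f → Unique e → Unique f
  conjugate-Unique e~f = Unique-↭ (conjugate⇒↭ e~f)

  conjugate-∈ : Conjugate G e f → a ∈ e → a ∈ f
  conjugate-∈ e~f = ∈-resp-↭ (conjugate⇒↭ e~f)

  Unique-head : Unique (a ∷ w) → a ∉ w
  Unique-head = Unique.Unique[x∷xs]⇒x∉xs

  Unique-mid : ∀ x c z → Unique (x ++ c ∷ z) → c ∉ x ++ z
  Unique-mid x c z xcz! = Unique-head (Unique-↭ (shift c x z) xcz!)

  ∈-insert : ∀ x c z → a ∈ x ++ z → a ∈ x ++ c ∷ z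
  ∈-insert x c z a∈ = ∈-resp-↭ (↭-sym (shift c x z)) (there a∈)

  ∈-delete : ∀ x c z → a ∈ x ++ c ∷ z → a ≢ c → a ∈ x ++ z
  ∈-delete x c z a∈ a≢c with ∈-resp-↭ (shift c x z) a∈
  ... | here a≡c = ⊥-elim (a≢c a≡c)
  ... | there a∈xz = a∈xz

  ∈-tail : a ∈ c ∷ w → a ≢ c → a ∈ w
  ∈-tail (here a≡c) a≢c = ⊥-elim (a≢c a≡c)
  ∈-tail (there a∈) _ = a∈

  Unique-delete : ∀ x c z → Unique (x ++ c ∷ z) → Unique (x ++ z)
  Unique-delete x c z xcz! with Unique-↭ (shift c x z) xcz!
  ... | _ ∷ xz! = xz!

  Unique-disjoint : ∀ x → Unique (x ++ z) → a ∈ x → b ∈ z → a ≢ b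
  Unique-disjoint (y ∷ x) (y∉ ∷ _) (here refl) b∈z = All.lookup y∉ (∈-++⁺ʳ x b∈z)
  Unique-disjoint (y ∷ x) (_ ∷ xz!) (there a∈x) b∈z = Unique-disjoint x xz! a∈x b∈z

  Count : Vertex → Word → ℕ
  Count a w = length (filter (a ≟_) w)

  Count≢0⇒∈ : ∀ w → Count a w ≢ 0 → a ∈ w
  Count≢0⇒∈ [] ≢0 = ⊥-elim (≢0 refl)
  Count≢0⇒∈ {a} (y ∷ w) ≢0 with a ≟ y
  ... | yes refl = here refl
  ... | no _ = there (Count≢0⇒∈ w ≢0)

  ∈⇒Count≢0 : a ∈ w → Count a w ≢ 0
  ∈⇒Count≢0 {a} {y ∷ w} a∈ with a ≟ y
  ... | yes _ = λ ()
  ... | no a≢y = ∈⇒Count≢0 (∈-tail a∈ a≢y)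

  Count-head : ∀ y w → Count y (y ∷ w) ≡ suc (Count y w)
  Count-head y w with y ≟ y
  ... | yes _ = refl
  ... | no y≢y = ⊥-elim (y≢y refl)

  Count-tail : ∀ a y w → Count a w ℕ.≤ Count a (y ∷ w)
  Count-tail a y w with a ≟ y
  ... | yes _ = ℕ.n≤1+n _
  ... | no _ = ℕ.≤-refl

  Count≤1⇒Unique : ∀ w → (∀ a → Count a w ℕ.≤ 1) → Unique w
  Count≤1⇒Unique [] _ = []
  Count≤1⇒Unique (y ∷ w) ≤1 =
    All.tabulate (λ {x} x∈w y≡x → ∈⇒Count≢0 (subst (_∈ w) (sym y≡x) x∈w) no-other-y) ∷
    Count≤1⇒Unique w (λ a → ℕ.≤-trans (Count-tail a y w) (≤1 a))
    where
      no-other-y : Count y w ≡ 0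
      no-other-y = ℕ.n≤0⇒n≡0 (ℕ.≤-pred (subst (ℕ._≤ 1) (Count-head y w) (≤1 y)))

  multilinear-unique : Multilinear G w → Unique w
  multilinear-unique {w} ml = Count≤1⇒Unique w (λ a → ℕ.≤-reflexive (ml a))

  multilinear-complete : Multilinear G w → ∀ a → a ∈ w
  multilinear-complete {w} ml a = Count≢0⇒∈ w (λ ≡0 → ℕ.1+n≢0 (trans (sym (ml a)) ≡0))

  data Prec : Word → Vertex → Vertex → Set where
    here  : ∀ {a b w} → b ∈ w → Prec (a ∷ w) a b
    there : ∀ {a b c w} → Prec w a b → Prec (c ∷ w) a b

  Prec-∈ˡ : Prec w a b → a ∈ w
  Prec-∈ˡ (here _) = here refl
  Prec-∈ˡ (there p) = there (Prec-∈ˡ p)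

  Prec-∈ʳ : Prec w a b → b ∈ w
  Prec-∈ʳ (here b∈) = there b∈
  Prec-∈ʳ (there p) = there (Prec-∈ʳ p)

  Prec-tail : Prec (c ∷ w) a b → a ≢ c → Prec w a b
  Prec-tail (here _) a≢c = ⊥-elim (a≢c refl)
  Prec-tail (there p) _ = p

  Prec-mid : ∀ x c z → d ∈ x → Prec (x ++ c ∷ z) d c
  Prec-mid (y ∷ x) c z (here refl) = here (∈-++⁺ʳ x (here refl))
  Prec-mid (y ∷ x) c z (there d∈x) = there (Prec-mid x c z d∈x)

  Prec-insert : ∀ x c z → Prec (x ++ z) a b → Prec (x ++ c ∷ z) a b
  Prec-insert [] c z p = there p
  Prec-insert (y ∷ x) c z (here b∈) with ∈-++⁻ x b∈
  ... | inj₁ b∈x = here (∈-++⁺ˡ b∈x)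
  ... | inj₂ b∈z = here (∈-++⁺ʳ x (there b∈z))
  Prec-insert (y ∷ x) c z (there p) = there (Prec-insert x c z p)

  Prec-before : ∀ {y} x z → Unique (x ++ y ∷ z) → Prec (x ++ y ∷ z) d y → d ∈ x
  Prec-before [] z yz! (here y∈z) = ⊥-elim (Unique-head yz! y∈z)
  Prec-before [] z yz! (there p) = ⊥-elim (Unique-head yz! (Prec-∈ʳ p))
  Prec-before (a ∷ x) z _ (here _) = here refl
  Prec-before (a ∷ x) z (_ ∷ xyz!) (there p) = there (Prec-before x z xyz! p)

  Prec-total : ∀ w → a ∈ w → b ∈ w → a ≢ b → Prec w a b ⊎ Prec w b a
  Prec-total (y ∷ w) (here refl) (here refl) a≢b = ⊥-elim (a≢b refl)
  Prec-total (y ∷ w) (here refl) (there b∈) _ = inj₁ (here b∈)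
  Prec-total (y ∷ w) (there a∈) (here refl) _ = inj₂ (here a∈)
  Prec-total (y ∷ w) (there a∈) (there b∈) a≢b = Sum.map there there (Prec-total w a∈ b∈ a≢b)

  Prec-asym : Unique w → Prec w a b → ¬ Prec w b a
  Prec-asym w! (here b∈) (here _) = Unique-head w! b∈
  Prec-asym w! (here _) (there p) = Unique-head w! (Prec-∈ʳ p)
  Prec-asym w! (there p) (here _) = Unique-head w! (Prec-∈ʳ p)
  Prec-asym (_ ∷ w!) (there p) (there q) = Prec-asym w! p q

  Prec-swap : ∀ u x y z → Prec (u ++ x ∷ y ∷ z) a b → ¬ (a ≡ x × b ≡ y)
              → Prec (u ++ y ∷ x ∷ z) a b
  Prec-swap [] x y z (here (here refl)) ne = ⊥-elim (ne (refl , refl))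
  Prec-swap [] x y z (here (there b∈)) _ = there (here b∈)
  Prec-swap [] x y z (there (here b∈)) _ = here (there b∈)
  Prec-swap [] x y z (there (there p)) _ = there (there p)
  Prec-swap (c ∷ u) x y z (here b∈) _ = here (∈-resp-↭ (++⁺ˡ u (↭-swap x y ↭-refl)) b∈)
  Prec-swap (c ∷ u) x y z (there p) ne = there (Prec-swap u x y z p ne)

  -- Commutation never exchanges two adjacent letters, so it preserves their order.
  Prec-≈ : v ≈ w → Adj a b → Prec v a b → Prec w a b
  Prec-≈ ε _ p = p
  Prec-≈ (fwd (swap u x y z (_ , ¬xy)) ◅ r) adj p =
    Prec-≈ r adj (Prec-swap u x y z p λ { (refl , refl) → ¬xy adj })
  Prec-≈ (bwd (swap u x y z (_ , ¬xy)) ◅ r) adj p =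
    Prec-≈ r adj (Prec-swap u y x z p λ { (refl , refl) → ¬xy (Adj-sym adj) })

  SameLetters : Word → Word → Set
  SameLetters v w = (∀ a → a ∈ v → a ∈ w) × (∀ a → a ∈ w → a ∈ v)

  Agree : Word → Word → Set
  Agree v w = ∀ a b → Adj a b → Prec v a b → Prec w a b

  orientation-criterion : ∀ v w → Unique v → Unique w → SameLetters v w → Agree v w → v ≈ w
  orientation-criterion [] [] _ _ _ _ = ε
  orientation-criterion (a ∷ v) [] _ _ (v⊆w , _) _ with v⊆w a (here refl)
  ... | ()
  orientation-criterion v (c ∷ w) v! cw! (v⊆cw , cw⊆v) agree with ∈-∃++ (cw⊆v c (here refl))
  ... | x , z , refl = ≈-trans (bubble x c z x-commutes-with-c) (≈-∷ c rest)
    where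
      c∉xz : c ∉ x ++ z
      c∉xz = Unique-mid x c z v!

      ≢c : a ∈ x ++ z → a ≢ c
      ≢c a∈ refl = c∉xz a∈

      -- a letter of x adjacent to c would precede c in c ∷ w, hence occur twice
      x-commutes-with-c : All (λ d → Commute G d c) x
      x-commutes-with-c = All.tabulate λ d∈x →
        ≢c (∈-++⁺ˡ d∈x) ,
        λ adj → Unique-head cw!
                  (Prec-∈ʳ (Prec-tail (agree _ _ adj (Prec-mid x c z d∈x)) (≢c (∈-++⁺ˡ d∈x))))

      rest : (x ++ z) ≈ w
      rest = orientation-criterion (x ++ z) w (Unique-delete x c z v!) (Unique-tail cw!)
        ((λ a a∈ → ∈-tail (v⊆cw a (∈-insert x c z a∈)) (≢c a∈)) ,
         (λ a a∈ → ∈-delete x c z (cw⊆v a (there a∈)) λ { refl → Unique-head cw! a∈ }))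
        (λ a b adj p → Prec-tail (agree a b adj (Prec-insert x c z p)) (≢c (Prec-∈ˡ p)))

  ≈-characterisation : Unique w → ((Unique v × SameLetters v w × Agree v w) ⇔ v ≈ w)
  ≈-characterisation {w} {v} w! = mk⇔
    (λ (v! , same , agree) → orientation-criterion v w v! w! same agree)
    (λ v≈w → Unique-≈ (≈-sym v≈w) w! ,
             ((λ a → ∈-≈ v≈w) , (λ a → ∈-≈ (≈-sym v≈w))) ,
             (λ a b adj → Prec-≈ v≈w adj))

  -- c is a source of w: it occurs in w and no adjacent letter occurs before it.
  -- For duplicate-free words these are exactly the minimal pieces.
  Source : Word → Vertex → Set
  Source w c = c ∈ w × (∀ d → Adj d c → ¬ Prec w d c)

  Source-≈ : v ≈ w → Source v c → Source w c
  Source-≈ v≈w (c∈v , c-min) = ∈-≈ v≈w c∈v , λ d adj p → c-min d adj (Prec-≈ (≈-sym v≈w) adj p)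

  head-Source : Unique (c ∷ w) → Source (c ∷ w) c
  head-Source cw! = here refl , λ { d adj (here c∈w) → Unique-head cw! c∈w
                                  ; d adj (there p) → Unique-head cw! (Prec-∈ʳ p) }

  -- A source commutes with everything before it, so it can be moved to the front.
  Source-to-front : Unique w → Source w c → ∃[ r ] (w ≈ c ∷ r)
  Source-to-front {c = c} w! (c∈w , c-min) with ∈-∃++ c∈w
  ... | x , z , refl = x ++ z , bubble x c z (All.tabulate λ d∈x →
        (λ { refl → Unique-mid x c z w! (∈-++⁺ˡ d∈x) }) , λ adj → c-min _ adj (Prec-mid x c z d∈x))

  ≈-head-Source : Unique w → (c ∷ v) ≈ w → Source w c
  ≈-head-Source w! cv≈w = Source-≈ cv≈w (head-Source (Unique-≈ (≈-sym cv≈w) w!))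

  -- Every source c of E sits at the front of some word of E, which is at most
  -- st(E); so st(E) begins with a letter ≥ c.
  Source≤st : Unique w → IsSt G s w → Source w c → ∃[ r ] ((c ∷ r) ≤lex s)
  Source≤st w! (_ , s-max) c-src with Source-to-front w! c-src
  ... | r , w≈cr = r , s-max _ (≈-sym w≈cr)

  st-nonempty : IsSt G [] w → a ∉ w
  st-nonempty ([]≈w , _) a∈w with ∈-≈ (≈-sym []≈w) a∈w
  ... | ()

  lookup-injective : Unique w → ∀ {i j} → lookup w i ≡ lookup w j → i ≡ j
  lookup-injective {w = y ∷ w} _ {Fin.zero} {Fin.zero} _ = refl
  lookup-injective {w = y ∷ w} yw! {Fin.zero} {Fin.suc j} y≡ =
    ⊥-elim (Unique-head yw! (subst (_∈ w) (sym y≡) (∈-lookup j)))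
  lookup-injective {w = y ∷ w} yw! {Fin.suc i} {Fin.zero} ≡y =
    ⊥-elim (Unique-head yw! (subst (_∈ w) ≡y (∈-lookup i)))
  lookup-injective {w = y ∷ w} yw! {Fin.suc i} {Fin.suc j} eq = cong Fin.suc (lookup-injective (Unique-tail yw!) eq)

  ∈⇒position : a ∈ w → ∃[ i ] (lookup w i ≡ a)
  ∈⇒position a∈ = index a∈ , sym (lookup-index a∈)

  positions⇒Prec : ∀ w {i j} → i Fin.< j → Prec w (lookup w i) (lookup w j)
  positions⇒Prec (y ∷ w) {Fin.zero} {Fin.suc j} _ = here (∈-lookup j)
  positions⇒Prec (y ∷ w) {Fin.suc i} {Fin.suc j} (ℕ.s≤s i<j) = there (positions⇒Prec w i<j)

  Prec⇒positions : Prec w a b → ∃₂ λ i j → i Fin.< j × lookup w i ≡ a × lookup w j ≡ b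
  Prec⇒positions (here b∈) with ∈⇒position b∈
  ... | j , refl = Fin.zero , Fin.suc j , ℕ.s≤s ℕ.z≤n , refl , refl
  Prec⇒positions (there p) with Prec⇒positions p
  ... | i , j , i<j , refl , refl = Fin.suc i , Fin.suc j , ℕ.s≤s i<j , refl , refl

  last-Below : ∀ {i j} → PieceLt G w i j → ∃[ k ] Below G w k j
  last-Below (step k<j) = _ , k<j
  last-Below (_ ∷ chain) = last-Below chain

  minimal⇒Source : Unique w → ∀ j → MinimalPiece G w j → Source w (lookup w j)
  minimal⇒Source {w} w! j j-min = ∈-lookup j , λ d adj p → no-predecessor d adj p
    where
      no-predecessor : ∀ d → Adj d (lookup w j) → ¬ Prec w d (lookup w j)
      no-predecessor d adj p with Prec⇒positions p
      ... | i , j′ , i<j′ , refl , j′≡j with lookup-injective w! j′≡j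
      ... | refl = j-min i (step (below i<j′ (inj₂ adj)))

  Source⇒minimal : Unique w → ∀ j → Source w (lookup w j) → MinimalPiece G w j
  Source⇒minimal {w} w! j (_ , j-min) i chain with last-Below chain
  ... | k , below k<j (inj₁ same) with lookup-injective w! same
  ...   | refl = Fin.<-irrefl refl k<j
  Source⇒minimal {w} w! j (_ , j-min) i chain | k , below k<j (inj₂ adj) =
    j-min (lookup w k) adj (positions⇒Prec w k<j)

  pyramid⇒sole-source : Unique w → ∀ {i} → PyramidWithBasis G w i → ∀ c → Source w c → c ≡ lookup w i
  pyramid⇒sole-source {w} w! (_ , i-unique) c c-src with ∈⇒position (proj₁ c-src)
  ... | k , refl = cong (lookup w) (i-unique k (Source⇒minimal w! k c-src))

  sole-source⇒pyramid : Unique w → ∀ i → (∀ c → Source w c → c ≡ lookup w i) → PyramidWithBasis G w i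
  sole-source⇒pyramid {w = y ∷ w} w! i sole = Source⇒minimal w! i i-src , λ k k-min →
    lookup-injective w! (sole _ (minimal⇒Source w! k k-min))
    where
      i-src : Source (y ∷ w) (lookup (y ∷ w) i)
      i-src = subst (Source (y ∷ w)) (sole y (head-Source w!)) (head-Source w!)

  -- Moving the first letter c of a word to the end
  -- reverses exactly the adjacent pairs containing c.  Recording how often each
  -- letter has been moved gives a height function h such that an adjacent pair
  -- a, b (a before b in e) keeps its order in the conjugate f when h a = h b and
  -- is reversed when h a = 1 + h b.
  Heights : Word → Word → (Vertex → ℕ) → Set
  Heights e f h = ∀ a b → Adj a b → Prec e a b →
                  (h a ≡ h b × Prec f a b) ⊎ (h a ≡ suc (h b) × Prec f b a)

  Heights-≈ : ∀ {h} → f ≈ t → Heights e f h → Heights e t h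
  Heights-≈ f≈t heights a b adj p =
    Sum.map (Product.map₂ (Prec-≈ f≈t adj)) (Product.map₂ (Prec-≈ f≈t (Adj-sym adj)))
            (heights a b adj p)

  raise : (Vertex → ℕ) → Vertex → Vertex → ℕ
  raise h c a with a ≟ c
  ... | yes _ = suc (h a)
  ... | no _ = h a

  raise-≡ : ∀ h c → raise h c c ≡ suc (h c)
  raise-≡ h c with c ≟ c
  ... | yes _ = refl
  ... | no c≢c = ⊥-elim (c≢c refl)

  raise-≢ : ∀ h {c a} → a ≢ c → raise h c a ≡ h a
  raise-≢ h {c} {a} a≢c with a ≟ c
  ... | yes a≡c = ⊥-elim (a≢c a≡c)
  ... | no _ = refl

  Prec-append : ∀ y → Prec w a b → Prec (w ++ [ y ]) a b
  Prec-append y (here b∈) = here (∈-++⁺ˡ b∈)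
  Prec-append y (there p) = there (Prec-append y p)

  Prec-last : ∀ y → a ∈ w → Prec (w ++ [ y ]) a y
  Prec-last {w = x ∷ w} y (here refl) = here (∈-++⁺ʳ w (here refl))
  Prec-last {w = x ∷ w} y (there a∈) = there (Prec-last y a∈)

  Heights-rotate : ∀ {h} → Unique (c ∷ w) → Heights e (c ∷ w) h → Heights e (w ++ [ c ]) (raise h c)
  Heights-rotate {c} {w} {h = h} cw! heights a b adj p = rotate (a ≟ c) (b ≟ c) (heights a b adj p)
    where
      open ≡-Reasoning

      not-after-c : ∀ {d} → Prec (c ∷ w) d c → d ≢ c → ⊥
      not-after-c q d≢c = Unique-head cw! (Prec-∈ʳ (Prec-tail q d≢c))

      rotate : Dec (a ≡ c) → Dec (b ≡ c) →
               (h a ≡ h b × Prec (c ∷ w) a b) ⊎ (h a ≡ suc (h b) × Prec (c ∷ w) b a) →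
               (raise h c a ≡ raise h c b × Prec (w ++ [ c ]) a b) ⊎
               (raise h c a ≡ suc (raise h c b) × Prec (w ++ [ c ]) b a)
      rotate (yes refl) (yes refl) _ = ⊥-elim (Adj-irrefl adj)
      rotate (yes refl) (no b≢c) (inj₂ (_ , q)) = ⊥-elim (not-after-c q b≢c)
      rotate (no a≢c) (yes refl) (inj₁ (_ , q)) = ⊥-elim (not-after-c q a≢c)
      rotate (yes refl) (no b≢c) (inj₁ (hc≡hb , q)) =
        inj₂ (height , Prec-last c (∈-tail (Prec-∈ʳ q) b≢c))
        where
          height : raise h c c ≡ suc (raise h c b)
          height = begin
            raise h c c       ≡⟨ raise-≡ h c ⟩
            suc (h c)         ≡⟨ cong suc hc≡hb ⟩
            suc (h b)         ≡⟨ cong suc (raise-≢ h b≢c) ⟨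
            suc (raise h c b) ∎
      rotate (no a≢c) (yes refl) (inj₂ (ha≡1+hc , q)) =
        inj₁ (height , Prec-last c (∈-tail (Prec-∈ʳ q) a≢c))
        where
          height : raise h c a ≡ raise h c c
          height = begin
            raise h c a ≡⟨ raise-≢ h a≢c ⟩
            h a         ≡⟨ ha≡1+hc ⟩
            suc (h c)   ≡⟨ raise-≡ h c ⟨
            raise h c c ∎
      rotate (no a≢c) (no b≢c) (inj₁ (ha≡hb , q)) =
        inj₁ (trans (raise-≢ h a≢c) (trans ha≡hb (sym (raise-≢ h b≢c))) ,
              Prec-append c (Prec-tail q a≢c))
      rotate (no a≢c) (no b≢c) (inj₂ (ha≡1+hb , q)) =
        inj₂ (trans (raise-≢ h a≢c) (trans ha≡1+hb (cong suc (sym (raise-≢ h b≢c)))) ,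
              Prec-append c (Prec-tail q b≢c))

  Heights-rotate-block : ∀ {h} u → Unique (u ++ v) → Heights e (u ++ v) h → ∃[ h′ ] Heights e (v ++ u) h′
  Heights-rotate-block {v} {h = h} [] v! heights = h , subst (λ t → Heights _ t h) (sym (++-identityʳ v)) heights
  Heights-rotate-block {v} (c ∷ u) cuv! heights =
    Product.map₂ (subst (λ t → Heights _ t _) (++-assoc v [ c ] u))
      (Heights-rotate-block {v = v ++ [ c ]} u uvc!
        (subst (λ t → Heights _ t _) (++-assoc u v [ c ]) (Heights-rotate cuv! heights)))
    where
      uvc! : Unique (u ++ v ++ [ c ])
      uvc! = subst Unique (++-assoc u v [ c ]) (Unique-↭ (++-comm [ c ] (u ++ v)) cuv!)

  conjugate-heights : Unique e → Conjugate G e f → ∃[ h ] Heights e f h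
  conjugate-heights {e} e! = go {h = λ _ → 0} e! (λ a b adj p → inj₁ (refl , p))
    where
      go : ∀ {t f h} → Unique t → Heights e t h → Conjugate G t f → ∃[ h′ ] Heights e f h′
      go {h = h} t! heights ε = h , heights
      go t! heights ((u , v , t≈uv , f′≈vu) ◅ cj) =
        let h′ , heights′ = Heights-rotate-block u (Unique-≈ t≈uv t!) (Heights-≈ t≈uv heights)
        in go (Unique-≈ (≈-sym f′≈vu) (Unique-↭ (++-comm u v) (Unique-≈ t≈uv t!)))
              (Heights-≈ (≈-sym f′≈vu) heights′) cj

  data Reach (w : Word) (m : Vertex) : Vertex → Set where
    start : Reach w m m
    next  : Reach w m a → Adj a b → Prec w a b → Reach w m b

  module _ {e f : Word} {h : Vertex → ℕ} (heights : Heights e f h) where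

    Heights-descend : Reach e m a → h a ℕ.≤ h m
    Heights-descend start = ℕ.≤-refl
    Heights-descend (next {a} {b} chain adj p) with heights a b adj p
    ... | inj₁ (ha≡hb , _) = ℕ.≤-trans (ℕ.≤-reflexive (sym ha≡hb)) (Heights-descend chain)
    ... | inj₂ (ha≡1+hb , _) =
      ℕ.≤-trans (ℕ.≤-trans (ℕ.n≤1+n _) (ℕ.≤-reflexive (sym ha≡1+hb))) (Heights-descend chain)

    Heights-from-f : Unique f → (∀ a → a ∈ f → a ∈ e) → Adj a b → Prec f a b →
                     (h a ≡ h b × Prec e a b) ⊎ h b ≡ suc (h a)
    Heights-from-f {a} {b} f! f⊆e adj p
      with Prec-total e (f⊆e a (Prec-∈ˡ p)) (f⊆e b (Prec-∈ʳ p)) (λ { refl → Adj-irrefl adj })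
    ... | inj₁ ab with heights a b adj ab
    ...   | inj₁ (ha≡hb , _) = inj₁ (ha≡hb , ab)
    ...   | inj₂ (_ , ba) = ⊥-elim (Prec-asym f! p ba)
    Heights-from-f {a} {b} f! f⊆e adj p | inj₂ ba with heights b a (Adj-sym adj) ba
    ...   | inj₁ (_ , ba′) = ⊥-elim (Prec-asym f! p ba′)
    ...   | inj₂ (hb≡1+ha , _) = inj₂ hb≡1+ha

    Heights-ascend : Unique f → (∀ a → a ∈ f → a ∈ e) → Reach f m a → h m ℕ.≤ h a
    Heights-ascend f! f⊆e start = ℕ.≤-refl
    Heights-ascend f! f⊆e (next chain adj p) with Heights-from-f f! f⊆e adj p
    ... | inj₁ (ha≡hb , _) = ℕ.≤-trans (Heights-ascend f! f⊆e chain) (ℕ.≤-reflexive ha≡hb)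
    ... | inj₂ hb≡1+ha =
      ℕ.≤-trans (Heights-ascend f! f⊆e chain) (ℕ.≤-trans (ℕ.n≤1+n _) (ℕ.≤-reflexive (sym hb≡1+ha)))

  PyramidWord : Vertex → Word → Set
  PyramidWord z w = ∀ c → c ∈ w → c ≢ z → ∃[ d ] (Adj d c × Prec w d c)

  PyramidWord-source : PyramidWord m w → Source w c → c ≡ m
  PyramidWord-source {m} {c = c} pyr (c∈ , c-min) with c ≟ m
  ... | yes c≡m = c≡m
  ... | no c≢m with pyr c c∈ c≢m
  ...   | d , adj , p = ⊥-elim (c-min d adj p)

  PyramidWord-snoc : ∀ {y r} → PyramidWord m w → r ∈ w → Adj r y → PyramidWord m (w ++ [ y ])
  PyramidWord-snoc {w = w} pyr r∈ adj c c∈ c≢m with ∈-++⁻ w c∈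
  ... | inj₁ c∈w = Product.map₂ (Product.map₂ (Prec-append _)) (pyr c c∈w c≢m)
  ... | inj₂ (here refl) = _ , adj , Prec-last c r∈

  -- If no letter of p is adjacent to a letter of w, then w ++ p ++ y ∷ q equals
  -- p ∘ (w ++ y ∷ q), which is conjugate to (w ++ [ y ]) ++ q ++ p.
  rotate-past : ∀ w p y q → Unique (w ++ p ++ y ∷ q) → All (λ x → ¬ Any (λ r → Adj r x) w) p →
                ConjStep G (w ++ p ++ y ∷ q) ((w ++ [ y ]) ++ q ++ p)
  rotate-past w p y q wpyq! p-free =
    p , w ++ y ∷ q , wp≈pw , ≡⇒≈ (trans (++-assoc w [ y ] (q ++ p)) (sym (++-assoc w (y ∷ q) p)))
    where
      commutes : All (λ r → All (Commute G r) p) w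
      commutes = All.tabulate λ r∈ → All.tabulate λ x∈ →
        Unique-disjoint w wpyq! r∈ (∈-++⁺ˡ x∈) , λ adj → All.lookup p-free x∈ (lose r∈ adj)

      wp≈pw : (w ++ p ++ y ∷ q) ≈ (p ++ w ++ y ∷ q)
      wp≈pw = ≈-trans (≡⇒≈ (sym (++-assoc w p (y ∷ q))))
              (≈-trans (≈-++ʳ (y ∷ q) (exchange w p commutes)) (≡⇒≈ (++-assoc p w (y ∷ q))))

  -- Primitivity.  If no letter satisfying P is adjacent to a letter violating P,
  -- the two classes commute, so the word factors as U ∘ V = V ∘ U.

  partition-≈ : ∀ {P : Vertex → Set} (P? : Decidable₁ P) → (∀ a b → P a → ¬ P b → Commute G a b) →
                ∀ w → w ≈ filter P? w ++ filter (¬? ∘ P?) w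
  partition-≈ P? cross [] = ε
  partition-≈ P? cross (y ∷ w) with P? y
  ... | yes Py = ≈-∷ y (partition-≈ P? cross w)
  ... | no ¬Py = ≈-trans (≈-∷ y (partition-≈ P? cross w))
    (≈-sym (bubble (filter P? w) y _ (All.map (λ Pd → cross _ y Pd ¬Py) (all-filter P? w))))

  primitive-connected : Primitive G e → (∀ a → a ∈ e) → ∀ {P : Vertex → Set} (P? : Decidable₁ P) →
                        P a → ¬ P b → ¬ (∀ x y → P x → ¬ P y → ¬ Adj x y)
  primitive-connected {e} {a} {b} prim complete {P} P? Pa ¬Pb no-edge =
    Sum.[ (λ A≡[] → ∉[] (subst (a ∈_) A≡[] (∈-filter⁺ P? (complete a) Pa))) ,
          (λ B≡[] → ∉[] (subst (b ∈_) B≡[] (∈-filter⁺ (¬? ∘ P?) (complete b) ¬Pb))) ]′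
      (prim A B (≈-sym e≈AB) (≈-trans (exchange B A B-commutes-with-A) (≈-sym e≈AB)))
    where
      A B : Word
      A = filter P? e
      B = filter (¬? ∘ P?) e

      cross : ∀ x y → P x → ¬ P y → Commute G x y
      cross x y Px ¬Py = (λ { refl → ¬Py Px }) , no-edge x y Px ¬Py

      e≈AB : e ≈ A ++ B
      e≈AB = partition-≈ P? cross e

      B-commutes-with-A : All (λ y → All (Commute G y) A) B
      B-commutes-with-A =
        All.map (λ ¬Py → All.map (λ Px → Commute-sym (cross _ _ Px ¬Py)) (all-filter P? e))
                (all-filter (¬? ∘ P?) e)

  -- Adjacency on finitely many vertices is decidable up to double negation, so
  -- it may be assumed decidable while proving a decidable proposition.
  assuming-decidable-adjacency : ∀ {P : Set} → Dec P → (Decidable Adj → P) → P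
  assuming-decidable-adjacency P? prove = decidable-stable P? λ ¬p →
    ¬¬-∀-Fin (λ a → ¬¬-∀-Fin (λ b → ¬¬-excluded-middle)) λ Adj? → ¬p (prove Adj?)

  module WithDecidableAdjacency (Adj? : Decidable Adj) where

    Prec? : ∀ w a b → Dec (Prec w a b)
    Prec? [] a b = no λ ()
    Prec? (c ∷ w) a b with c ≟ a | b ∈? w | Prec? w a b
    ... | yes refl | yes b∈ | _ = yes (here b∈)
    ... | _ | _ | yes p = yes (there p)
    ... | no c≢a | _ | no ¬p = no λ { (here _) → c≢a refl ; (there p) → ¬p p }
    ... | yes refl | no b∉ | no ¬p = no λ { (here b∈) → b∉ b∈ ; (there p) → ¬p p }

    ≈? : Unique w → ∀ v → Dec (v ≈ w)
    ≈? {w} w! v = Dec.map (≈-characterisation w!)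
      (unique? v ×-dec
        (Fin.all? (λ a → a ∈? v →-dec a ∈? w) ×-dec Fin.all? (λ a → a ∈? w →-dec a ∈? v)) ×-dec
        Fin.all? (λ a → Fin.all? λ b → Adj? a b →-dec (Prec? v a b →-dec Prec? w a b)))

    -- st(E) exists: the largest word of length |w| equivalent to w.
    st-exists : Unique w → ∃[ s ] IsSt G s w
    st-exists {w} w! with ≤lex-maximum w (filter (≈? w!) (words (length w)))
    ... | s , s∈ , s-max = s , represents s∈ , λ v v≈w →
      s-max (there (∈-filter⁺ (≈? w!) (subst (λ k → v ∈ words k) (↭-length (≈⇒↭ v≈w)) (∈-words v))
                              v≈w))
      where
        represents : s ∈ w ∷ filter (≈? w!) (words (length w)) → s ≈ w
        represents (here refl) = ε
        represents (there s∈) = proj₂ (∈-filter⁻ (≈? w!) {xs = words (length w)} s∈)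

    -- If m is the only source of a duplicate-free word w, every letter of w is
    -- reachable from m: scanning w from the left, each letter is either a
    -- source (hence m) or has an adjacent, already reached, predecessor.
    sole-source⇒reach : Unique w → (∀ c → Source w c → c ≡ m) → a ∈ w → Reach w m a
    sole-source⇒reach {w} {m} w! sole = scan [] w refl (λ ())
      where
        scan : ∀ x z → w ≡ x ++ z → (∀ {a} → a ∈ x → Reach w m a) → ∀ {a} → a ∈ w → Reach w m a
        scan x [] w≡x reached a∈w = reached (subst (_ ∈_) (trans w≡x (++-identityʳ x)) a∈w)
        scan x (y ∷ z) w≡xyz reached = scan (x ++ [ y ]) z (trans w≡xyz (sym (++-assoc x [ y ] z))) reached′
          where
            at-y : ∀ {d} → Prec (x ++ y ∷ z) d y → Prec w d y
            at-y = subst (λ t → Prec t _ y) (sym w≡xyz)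

            reach-y : Reach w m y
            reach-y with any? (λ d → Adj? d y) x
            ... | yes adjacent with find adjacent
            ...   | d , d∈x , adj = next (reached d∈x) adj (at-y (Prec-mid x y z d∈x))
            reach-y | no ¬adjacent = subst (Reach w m) (sym (sole y y-source)) start
              where
                y-source : Source w y
                y-source = subst (y ∈_) (sym w≡xyz) (∈-++⁺ʳ x (here refl)) , λ d adj p →
                  ¬adjacent (lose (Prec-before x z (subst Unique w≡xyz w!) (subst (λ t → Prec t d y) w≡xyz p))
                                  adj)

            reached′ : ∀ {a} → a ∈ x ++ [ y ] → Reach w m a
            reached′ a∈ with ∈-++⁻ x a∈
            ... | inj₁ a∈x = reached a∈x
            ... | inj₂ (here refl) = reach-y

    -- Two conjugate duplicate-free words with the same sole source m are
    -- equivalent: along chains from m the heights can only fall in e and only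
    -- rise in f, so all heights agree and no adjacent pair has been reversed.
    conjugate-pyramids-≈ : Unique e → (∀ c → Source e c → c ≡ m) → Conjugate G e f →
                           (∀ c → Source f c → c ≡ m) → f ≈ e
    conjugate-pyramids-≈ {e} {m} {f} e! e-sole e~f f-sole =
      orientation-criterion f e f! e! (f⊆e , e⊆f) agree
      where
        f! : Unique f
        f! = conjugate-Unique e~f e!
        f⊆e : ∀ a → a ∈ f → a ∈ e
        f⊆e a = ∈-resp-↭ (↭-sym (conjugate⇒↭ e~f))
        e⊆f : ∀ a → a ∈ e → a ∈ f
        e⊆f a = conjugate-∈ e~f

        h : Vertex → ℕ
        h = proj₁ (conjugate-heights e! e~f)
        heights : Heights e f h
        heights = proj₂ (conjugate-heights e! e~f)

        level : ∀ a → a ∈ e → h a ≡ h m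
        level a a∈ = ℕ.≤-antisym (Heights-descend heights (sole-source⇒reach e! e-sole a∈))
                                 (Heights-ascend heights f! f⊆e (sole-source⇒reach f! f-sole (e⊆f a a∈)))

        agree : Agree f e
        agree a b adj p with Heights-from-f heights f! f⊆e adj p
        ... | inj₁ (_ , q) = q
        ... | inj₂ hb≡1+ha = ⊥-elim (ℕ.1+n≢n (begin
          suc (h a) ≡⟨ hb≡1+ha ⟨
          h b       ≡⟨ level b (f⊆e b (Prec-∈ʳ p)) ⟩
          h m       ≡⟨ level a (f⊆e a (Prec-∈ˡ p)) ⟨
          h a       ∎))
          where open ≡-Reasoning

    -- A prefix R containing m of a conjugate R ++ U of a primitive word e with
    -- all vertices, followed by a nonempty U with no letter adjacent to R,
    -- would split e into two non-adjacent classes.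
    detached : Primitive G e → (∀ a → a ∈ e) → Unique e → ∀ R U → U ≢ [] →
               Conjugate G e (R ++ U) → m ∈ R → ¬ All (λ y → ¬ Any (λ r → Adj r y) R) U
    detached _ _ _ R [] U≢[] _ _ _ = U≢[] refl
    detached {e} {m} prim complete e! R (y₀ ∷ U) _ e~RU m∈R unattached =
      primitive-connected prim complete (_∈? R) m∈R
        (λ y₀∈R → Unique-disjoint R RU! y₀∈R (here refl) refl) no-edge
      where
        RU! : Unique (R ++ y₀ ∷ U)
        RU! = conjugate-Unique e~RU e!

        no-edge : ∀ x y → x ∈ R → y ∉ R → ¬ Adj x y
        no-edge x y x∈R y∉R adj with ∈-++⁻ R (conjugate-∈ e~RU (complete y))
        ... | inj₁ y∈R = y∉R y∈R
        ... | inj₂ y∈U = All.lookup unattached y∈U (lose x∈R adj)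

    -- With e conjugate to R ++ U, R a pyramid
    -- word containing m, the first letter y of U adjacent to R is preceded by a
    -- block commuting with R; rotating that block to the end appends y to R.
    grow-pyramid : Primitive G e → (∀ a → a ∈ e) → Unique e → ∀ k R U → length U ≡ k →
                   Conjugate G e (R ++ U) → PyramidWord m R → m ∈ R →
                   ∃[ f ] (Conjugate G e f × PyramidWord m f)
    grow-pyramid _ _ _ zero R [] _ e~R pyr _ = R , subst (Conjugate G _) (++-identityʳ R) e~R , pyr
    grow-pyramid {e} {m} prim complete e! (suc k) R U len e~RU pyr m∈R
      with cofirst? (λ y → any? (λ r → Adj? r y) R) U
    ... | no none = ⊥-elim (detached prim complete e! R U (λ { refl → ℕ.0≢1+n len }) e~RU m∈R
                                     (¬First⇒All (λ ¬P → ¬P) none))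
    ... | yes attached with toView attached
    ...   | _before_then_ {p} {y} p-free y-attached q with find y-attached
    ...     | r , r∈R , adj =
      grow-pyramid prim complete e! k (R ++ [ y ]) (q ++ p) len′
        (e~RU ◅◅ (rotate-past R p y q (conjugate-Unique e~RU e!) p-free ◅ ε))
        (PyramidWord-snoc pyr r∈R adj) (∈-++⁺ˡ m∈R)
      where
        len′ : length (q ++ p) ≡ k
        len′ = trans (length-++-comm q p) (ℕ.suc-injective (trans (sym (length-++-sucʳ p y q)) len))

    pyramid-conjugate : Primitive G e → (∀ a → a ∈ e) → Unique e → ∀ m →
                        ∃[ f ] (Conjugate G e f × PyramidWord m f)
    pyramid-conjugate prim complete e! m with ∈-∃++ (complete m)
    ... | x , y , refl =
      grow-pyramid prim complete e! _ [ m ] (y ++ x) refl ((x , m ∷ y , ε , ε) ◅ ε)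
        (λ { c (here refl) c≢m → ⊥-elim (c≢m refl) }) (here refl)

    -- If E is Lyndon, every source c of E satisfies c ≤ head st(E) ≤ head st(F)
    -- = z, where F is a conjugate of E which is a pyramid word with basis z.
    Lyndon-source-bound : Unique e → (∀ a → a ∈ e) → Lyndon G e → ∀ z → Source e c → c Fin.≤ z
    Lyndon-source-bound {e} {c} e! complete (_ , prim , minimal) z c-src
      with pyramid-conjugate prim complete e! z
    ... | f , e~f , pyr with st-exists e! | st-exists (conjugate-Unique e~f e!)
    ...   | s , st-e | [] , st-f = ⊥-elim (st-nonempty st-f (conjugate-∈ e~f (complete z)))
    ...   | s , st-e | t₀ ∷ t , st-f@(t≈f , _) =
      subst (c Fin.≤_) t₀≡z (≤lex-head (≤lex-trans c·r≤s s≤t))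
      where
        c·r≤s : (c ∷ proj₁ (Source≤st e! st-e c-src)) ≤lex s
        c·r≤s = proj₂ (Source≤st e! st-e c-src)

        s≤t : s ≤lex (t₀ ∷ t)
        s≤t = minimal f e~f s (t₀ ∷ t) st-e st-f

        t₀≡z : t₀ ≡ z
        t₀≡z = PyramidWord-source pyr (≈-head-Source (conjugate-Unique e~f e!) t≈f)

  -- (⇐) A pyramid E with basis m.  Its only source m begins every word of E, so
  -- E admits no factorisation U ∘ V = V ∘ U with U and V nonempty.
  sole-source⇒primitive : Unique e → (∀ c → Source e c → c ≡ m) → Primitive G e
  sole-source⇒primitive e! sole [] v _ _ = inj₁ refl
  sole-source⇒primitive e! sole (a ∷ u) [] _ _ = inj₂ refl
  sole-source⇒primitive {e} e! sole (a ∷ u) (c ∷ v) au·cv≈e cv·au≈e =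
    ⊥-elim (Unique-head (Unique-≈ (≈-sym au·cv≈e) e!)
                        (subst (_∈ u ++ c ∷ v) c≡a (∈-++⁺ʳ u (here refl))))
    where
      c≡a : c ≡ a
      c≡a = trans (sole c (≈-head-Source e! cv·au≈e)) (sym (sole a (≈-head-Source e! au·cv≈e)))

  -- If moreover m is the least vertex, E ≤ F for every conjugate F: st(E) begins
  -- with m, and st(F) begins with a letter ≥ m; if that letter is m, it bounds
  -- every source of F, so F is a pyramid with basis m and hence F = E.
  least-pyramid-minimal : Unique e → (∀ a → a ∈ e) → (∀ c → Source e c → c ≡ m) → (∀ a → m Fin.≤ a) →
                          ∀ f → Conjugate G e f → HeapLe G e f
  least-pyramid-minimal {e} {m} e! complete sole least f e~f s t st-e st-f =
    assuming-decidable-adjacency (s ≤lex? t) λ Adj? → compare Adj? s t st-e st-f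
    where
      compare : Decidable Adj → ∀ s t → IsSt G s e → IsSt G t f → s ≤lex t
      compare _ [] t _ _ = []≤
      compare _ (s₀ ∷ s) [] _ st-f = ⊥-elim (st-nonempty st-f (conjugate-∈ e~f (complete m)))
      compare Adj? (s₀ ∷ s) (t₀ ∷ t) (s≈e , _) st-f@(_ , t-max) with t₀ ≟ m
      ... | no t₀≢m =
        head< (subst (Fin._< t₀) (sym s₀≡m) (Fin.≤∧≢⇒< (least t₀) (λ m≡t₀ → t₀≢m (sym m≡t₀))))
        where
          s₀≡m : s₀ ≡ m
          s₀≡m = sole s₀ (≈-head-Source e! s≈e)
      ... | yes refl = t-max (s₀ ∷ s) (≈-trans s≈e (≈-sym f≈e))
        where
          f! : Unique f
          f! = conjugate-Unique e~f e!

          f≈e : f ≈ e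
          f≈e = WithDecidableAdjacency.conjugate-pyramids-≈ Adj? e! sole e~f λ c c-src →
            Fin.≤-antisym (≤lex-head (proj₂ (Source≤st f! st-f c-src))) (least c)

  admissible⇒Lyndon : Multilinear G e → AdmissiblePyramid G e → Lyndon G e
  admissible⇒Lyndon {e} ml (i , pyr , least) =
    nonempty , sole-source⇒primitive e! sole , least-pyramid-minimal e! complete sole least-vertex
    where
      e! : Unique e
      e! = multilinear-unique ml

      complete : ∀ a → a ∈ e
      complete = multilinear-complete ml

      sole : ∀ c → Source e c → c ≡ lookup e i
      sole = pyramid⇒sole-source e! pyr

      nonempty : e ≢ []
      nonempty e≡[] with subst (λ w → Fin (length w)) e≡[] i
      ... | ()

      least-vertex : ∀ a → lookup e i Fin.≤ a
      least-vertex a = subst (lookup e i Fin.≤_) (sym (lookup-index (complete a))) (least _)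

  Lyndon-sole-source : Unique e → (∀ a → a ∈ e) → Lyndon G e → (∀ a → m Fin.≤ a) →
                       ∀ c → Source e c → c ≡ m
  Lyndon-sole-source {m = m} e! complete lyndon least c c-src =
    assuming-decidable-adjacency (c ≟ m) λ Adj? →
      Fin.≤-antisym (WithDecidableAdjacency.Lyndon-source-bound Adj? e! complete lyndon m c-src) (least c)

  Lyndon⇒admissible : Multilinear G e → Lyndon G e → (∀ a → m Fin.≤ a) → AdmissiblePyramid G e
  Lyndon⇒admissible {e} {m} ml lyndon least =
    i , sole-source⇒pyramid e! i sole , λ j → subst (Fin._≤ lookup e j) m≡ (least _)
    where
      e! : Unique e
      e! = multilinear-unique ml

      complete : ∀ a → a ∈ e
      complete = multilinear-complete ml

      i : Fin (length e)
      i = index (complete m)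

      m≡ : m ≡ lookup e i
      m≡ = lookup-index (complete m)

      sole : ∀ c → Source e c → c ≡ lookup e i
      sole c c-src = trans (Lyndon-sole-source e! complete lyndon least c c-src) m≡

-- Lemma 2.3.  On a graph with no vertices the only word is empty, which is
-- neither Lyndon nor a pyramid; otherwise vertex 0 is the least vertex.
lemma2p3 : (n : ℕ) (G : SimpleGraph n) (e : List (Fin n)) → Multilinear G e →
    (Lyndon G e ⇔ AdmissiblePyramid G e)
lemma2p3 zero G [] ml = mk⇔ (λ lyndon → ⊥-elim (proj₁ lyndon refl)) (admissible⇒Lyndon G ml)
lemma2p3 zero G (() ∷ _) ml
lemma2p3 (suc n) G e ml =
  mk⇔ (λ lyndon → Lyndon⇒admissible G ml lyndon (λ _ → ℕ.z≤n)) (admissible⇒Lyndon G ml)
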